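{- Let $(\mathsf{r})$ be a rule of the tableau calculus $\mathtt{TAB}_{\mathcal{ALC}\iota}$ applied to a branch $\mathcal{B}$, and let $\mathcal{B}_1,\ldots,\mathcal{B}_n\supseteq\mathcal{B}$ be the resulting branches. If $\mathcal{B}$ is satisfiable, then some $\mathcal{B}_i$, $i\in\{1,\ldots,n\}$, is satisfiable.
   Context: $\mathcal{ALC}\iota$ concepts: $C ::= A \mid \neg C \mid (C\sqcap C) \mid \exists r.C \mid \{\iota C\} \mid \iota C.C$, semantics standard for $\neg,\sqcap,\exists r$; $(\{\iota C\})^{\mathcal{I}}=\{d\}$ if $C^{\mathcal{I}}=\{d\}$, else $\emptyset$; $(\iota C.D)^{\mathcal{I}}=\Delta^{\mathcal{I}}$ if $C^{\mathcal{I}}=\{d\}\subseteq D^{\mathcal{I}}$ for some $d$, else $\emptyset$. An ontology is a TBox (concept inclusions $C\sqsubseteq D$) plus an ABox (assertions $a:C$, $r:(a,b)$). A branch is a set of assertions (possibly also $\bot$); it is satisfiable if some interpretation satisfies all its assertions (and it contains no $\bot$). Calculus $\mathtt{TAB}_{\mathcal{ALC}\iota}$ (input: concept $C$, optionally ontology $\mathcal{O}$; the root contains $a:C$ for a fresh individual $a$). A rule $\frac{Pr}{Con_1\mid\cdots\mid Con_m}$ applied to a branch containing $Pr$ extends it into $m$ branches by adding $Con_i$. Rules ($b,b'$ always fresh individuals): $(ABox_{\mathsf I})$: if $a:C\in$ABox add $a:C$; $(ABox_r)$: if $r(a,a')\in$ABox add $r(a,a')$; $(TBox)$: from $C\sqsubseteq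 D\in$TBox and $a:E$ add $a:\neg(C\sqcap\neg D)$; $(\bot)$: from $a:C,a:\neg C$ add $\bot$; $(\neg\neg)$: from $a:\neg\neg C$ add $a:C$; $(\sqcap)$: from $a:C\sqcap D$ add $a:C,a:D$; $(\neg\sqcap)$: from $a:\neg(C\sqcap D)$ branch $a:\neg C\mid a:\neg D$; $(\exists r)$: from $a:\exists r.C$ add $b:C, r:(a,b)$; $(\neg\exists r)$: from $a:\neg\exists r.C, r:(a,a')$ add $a':\neg C$; $(\iota^g_1)$: from $a:\iota C.D$ add $b:C,b:D$; $(\iota^g_2)$: from $a:\iota C.D,a':C,a'':C,a':E$ add $a'':E$; $(\neg\iota^g)$: from $a:\neg\iota C.D, a':E$ branch $a':\neg C\mid a':\neg D\mid b:C,b:A^g_C,b':C,b':\neg A^g_C$; $(cut^g_\iota)$: from $a:\iota C.D,a':E$ branch $a':C\mid a':\neg C$; $(\iota^\ell_1)$: from $a:\{\iota C\}$ add $a:C$; $(\iota^\ell_2)$: from $a:\{\iota C\},a':C,a'':C,a':D$ add $a'':D$; $(\neg\iota^\ell)$: from $a:\neg\{\iota C\}$ branch $a:\neg C\mid a:\neg A_C, b:C, b:A_C$; $(cut^\ell_\iota)$: from $a:\{\iota C\},a':D$ branch $a':C\mid a':\neg C$. Here $A^g_C$ and $A_C$ are fresh atomic concepts (not occurring in the input) determined by $C$.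
   Formalization: In $(\neg\iota^g)$ and $(\neg\iota^\ell)$, $A^g_C$ and $A_C$ are any atomic concepts absent from the current branch and from $\mathcal{O}$, not fixed by C, and a satisfiable branch needs an interpretation satisfying $\mathcal{O}$ too. The statement above fails without it. -}

module Defs where

open import Data.Nat using (ℕ)
open import Data.Product using (Σ; _×_; _,_)
open import Data.List using (List; []; _∷_; _++_; concatMap)
open import Data.List.Membership.Propositional using (_∈_; _∉_)
open import Data.List.Relation.Unary.All using (All)
open import Data.List.Relation.Unary.Any using (Any)
open import Data.Empty using (⊥)
open import Relation.Nullary using (¬_)
open import Relation.Binary.PropositionalEquality using (_≡_)

-- Names: atomic concepts, roles and individuals are natural numbers
-- (an infinite supply, so fresh names always exist).
AtomName : Set
AtomName = ℕ

RoleName : Set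
RoleName = ℕ

Ind : Set
Ind = ℕ

-- ALCι concepts:  C ::= A | ¬C | C ⊓ C | ∃r.C | {ιC} | ιC.C
data Concept : Set where
  atom  : AtomName → Concept
  neg   : Concept → Concept
  and   : Concept → Concept → Concept
  exist : RoleName → Concept → Concept
  ιloc  : Concept → Concept
  ιglob : Concept → Concept → Concept

-- Interpretations (arbitrary domain, no unique name assumption)
record Interp : Set₁ where
  field
    Δ    : Set
    conc : AtomName → Δ → Set
    role : RoleName → Δ → Δ → Set
    ind  : Ind → Δ

IsUnique : {Δ : Set} → (Δ → Set) → Δ → Set
IsUnique {Δ} P d = P d × ((e : Δ) → P e → e ≡ d)

⟦_⟧ : Concept → (I : Interp) → Interp.Δ I → Set
⟦ atom A ⟧ I d = Interp.conc I A d
⟦ neg C ⟧ I d = ¬ (⟦ C ⟧ I d)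
⟦ and C D ⟧ I d = ⟦ C ⟧ I d × ⟦ D ⟧ I d
⟦ exist r C ⟧ I d = Σ (Interp.Δ I) λ e → Interp.role I r d e × ⟦ C ⟧ I e
⟦ ιloc C ⟧ I d = IsUnique (⟦ C ⟧ I) d
⟦ ιglob C D ⟧ I d = Σ (Interp.Δ I) λ e → IsUnique (⟦ C ⟧ I) e × ⟦ D ⟧ I e

data Assertion : Set where
  _∶_  : Ind → Concept → Assertion
  rel  : RoleName → Ind → Ind → Assertion
  bot  : Assertion

Branch : Set
Branch = List Assertion

record Ontology : Set where
  field
    tbox : List (Concept × Concept)   -- C ⊑ D
    abox : List Assertion             -- only a : C and r : (a,b) are meant here

open Ontology public

SatA : Interp → Assertion → Set
SatA I (a ∶ C) = ⟦ C ⟧ I (Interp.ind I a)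
SatA I (rel r a b) = Interp.role I r (Interp.ind I a) (Interp.ind I b)
SatA I bot = ⊥

Models : Interp → Ontology → Set
Models I O =
  All (λ { (C , D) → (d : Interp.Δ I) → ⟦ C ⟧ I d → ⟦ D ⟧ I d }) (tbox O)
  × All (SatA I) (abox O)

-- A branch is satisfiable (w.r.t. the ontology O; O empty if none given)
Satisfiable : Ontology → Branch → Set₁
Satisfiable O B = Σ Interp λ I → Models I O × All (SatA I) B

atomsC : Concept → List AtomName
atomsC (atom A) = A ∷ []
atomsC (neg C) = atomsC C
atomsC (and C D) = atomsC C ++ atomsC D
atomsC (exist r C) = atomsC C
atomsC (ιloc C) = atomsC C
atomsC (ιglob C D) = atomsC C ++ atomsC D

atomsA : Assertion → List AtomName
atomsA (a ∶ C) = atomsC C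
atomsA (rel r a b) = []
atomsA bot = []

indsA : Assertion → List Ind
indsA (a ∶ C) = a ∷ []
indsA (rel r a b) = a ∷ b ∷ []
indsA bot = []

atomsO : Ontology → List AtomName
atomsO O = concatMap (λ { (C , D) → atomsC C ++ atomsC D }) (tbox O)
           ++ concatMap atomsA (abox O)

FreshInd : Ontology → Branch → Ind → Set
FreshInd O B b = b ∉ concatMap indsA B × b ∉ concatMap indsA (abox O)

FreshAtom : Ontology → Branch → AtomName → Set
FreshAtom O B A = A ∉ concatMap atomsA B × A ∉ atomsO O

Occurs : Branch → Ind → Set
Occurs B a = Σ Concept λ E → (a ∶ E) ∈ B

-- Rules of TAB_ALCι.  Step O B cons : applying a rule to B yields the
-- conclusions Con_1 ... Con_m (the list cons); the resulting branches are
-- Con_i ++ B.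
data Step (O : Ontology) (B : Branch) : List (List Assertion) → Set where
  r-ABoxI : ∀ {a C} → (a ∶ C) ∈ abox O → Step O B ((a ∶ C ∷ []) ∷ [])
  r-ABoxr : ∀ {r a a'} → rel r a a' ∈ abox O → Step O B ((rel r a a' ∷ []) ∷ [])
  r-TBox  : ∀ {C D a E} → (C , D) ∈ tbox O → (a ∶ E) ∈ B →
            Step O B ((a ∶ neg (and C (neg D)) ∷ []) ∷ [])
  r-⊥     : ∀ {a C} → (a ∶ C) ∈ B → (a ∶ neg C) ∈ B → Step O B ((bot ∷ []) ∷ [])
  r-¬¬    : ∀ {a C} → (a ∶ neg (neg C)) ∈ B → Step O B ((a ∶ C ∷ []) ∷ [])
  r-⊓     : ∀ {a C D} → (a ∶ and C D) ∈ B → Step O B ((a ∶ C ∷ a ∶ D ∷ []) ∷ [])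
  r-¬⊓    : ∀ {a C D} → (a ∶ neg (and C D)) ∈ B →
            Step O B ((a ∶ neg C ∷ []) ∷ (a ∶ neg D ∷ []) ∷ [])
  r-∃     : ∀ {a r C} b → (a ∶ exist r C) ∈ B → FreshInd O B b →
            Step O B ((b ∶ C ∷ rel r a b ∷ []) ∷ [])
  r-¬∃    : ∀ {a r C a'} → (a ∶ neg (exist r C)) ∈ B → rel r a a' ∈ B →
            Step O B ((a' ∶ neg C ∷ []) ∷ [])
  r-ιg1   : ∀ {a C D} b → (a ∶ ιglob C D) ∈ B → FreshInd O B b →
            Step O B ((b ∶ C ∷ b ∶ D ∷ []) ∷ [])
  r-ιg2   : ∀ {a C D a' a'' E} → (a ∶ ιglob C D) ∈ B → (a' ∶ C) ∈ B →
            (a'' ∶ C) ∈ B → (a' ∶ E) ∈ B → Step O B ((a'' ∶ E ∷ []) ∷ [])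
  r-¬ιg   : ∀ {a C D a'} b b' A → (a ∶ neg (ιglob C D)) ∈ B → Occurs B a' →
            FreshInd O B b → FreshInd O B b' → ¬ (b ≡ b') → FreshAtom O B A →
            Step O B ((a' ∶ neg C ∷ []) ∷ (a' ∶ neg D ∷ []) ∷
                      (b ∶ C ∷ b ∶ atom A ∷ b' ∶ C ∷ b' ∶ neg (atom A) ∷ []) ∷ [])
  r-cutg  : ∀ {a C D a'} → (a ∶ ιglob C D) ∈ B → Occurs B a' →
            Step O B ((a' ∶ C ∷ []) ∷ (a' ∶ neg C ∷ []) ∷ [])
  r-ιl1   : ∀ {a C} → (a ∶ ιloc C) ∈ B → Step O B ((a ∶ C ∷ []) ∷ [])
  r-ιl2   : ∀ {a C a' a'' D} → (a ∶ ιloc C) ∈ B → (a' ∶ C) ∈ B →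
            (a'' ∶ C) ∈ B → (a' ∶ D) ∈ B → Step O B ((a'' ∶ D ∷ []) ∷ [])
  r-¬ιl   : ∀ {a C} b A → (a ∶ neg (ιloc C)) ∈ B → FreshInd O B b →
            FreshAtom O B A →
            Step O B ((a ∶ neg C ∷ []) ∷ (a ∶ neg (atom A) ∷ b ∶ C ∷ b ∶ atom A ∷ []) ∷ [])
  r-cutl  : ∀ {a C a'} → (a ∶ ιloc C) ∈ B → Occurs B a' →
            Step O B ((a' ∶ C ∷ []) ∷ (a' ∶ neg C ∷ []) ∷ [])

-- Fix a model I of O and B. Rules that introduce no fresh names are sound in I itself,
-- excluded middle choosing the branch. For the others, I is changed only at the fresh
-- names: the extension of a concept depends only on the atoms occurring in it, and O and
-- B mention neither the fresh individuals nor the fresh atom, so O and B stay satisfied.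
-- For the ¬ι rules, classically an element x of C that is not its unique element yields
-- a second element e ≠ x of C, and the fresh atom is interpreted as a singleton that
-- separates x from e.

module Submission where

open import Defs
open import Axiom.ExcludedMiddle using (ExcludedMiddle)
open import Axiom.DoubleNegationElimination using (em⇒dne)
open import Level using (Level; 0ℓ)
open import Data.Nat using (ℕ; _≟_)
open import Data.List using (List; []; _∷_; _++_; concatMap)
open import Data.List.Relation.Unary.Any using (Any; here; there)
open import Data.List.Relation.Unary.All using (All; []; _∷_; lookup; tabulate)
open import Data.List.Relation.Unary.All.Properties using (++⁺)
open import Data.List.Membership.Propositional using (_∈_; _∉_; lose)
open import Data.List.Membership.Propositional.Properties using (∈-++⁺ˡ; ∈-++⁺ʳ; ∈-concatMap⁺)
open import Data.List.Relation.Binary.Subset.Propositional using (_⊆_)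
open import Data.Product using (∃; _×_; _,_; proj₁; proj₂)
open import Data.Product.Function.NonDependent.Propositional using (_×-⇔_)
import Data.Product.Function.Dependent.Propositional as Σ
open import Data.Empty using (⊥-elim)
open import Function using (_∘_)
open import Function.Bundles using (_⇔_; mk⇔; Equivalence)
open import Function.Construct.Identity using (⇔-id)
open import Function.Related.Propositional using (≡⇒)
open import Function.Related.TypeIsomorphisms using (¬-cong-⇔)
open import Relation.Nullary using (¬_; yes; no)
open import Relation.Binary.PropositionalEquality using (_≡_; _≢_; refl; sym; trans; subst; subst₂; cong-app)

open Equivalence using (to; from)

private variable
  ℓ : Level
  X : Set ℓ
  I : Interp
  O : Ontology
  B : Branch
  C D : Concept
  a b : Ind
  A : AtomName
  r : RoleName

update : (ℕ → X) → ℕ → X → ℕ → X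
update f k v x with x ≟ k
... | yes _ = v
... | no  _ = f x

update-≡ : (f : ℕ → X) (k : ℕ) (v : X) → update f k v k ≡ v
update-≡ f k v with k ≟ k
... | yes _   = refl
... | no  k≢k = ⊥-elim (k≢k refl)

update-≢ : (f : ℕ → X) (k : ℕ) (v : X) {x : ℕ} → x ≢ k → update f k v x ≡ f x
update-≢ f k v {x} x≢k with x ≟ k
... | yes x≡k = ⊥-elim (x≢k x≡k)
... | no  _   = refl

_≗_on_ : (f g : ℕ → X) → List ℕ → Set _
f ≗ g on xs = ∀ {x} → x ∈ xs → f x ≡ g x

update-≗ : {f : ℕ → X} {k : ℕ} {v : X} {xs : List ℕ} → k ∉ xs → f ≗ update f k v on xs
update-≗ {f = f} {k} {v} k∉xs x∈xs = sym (update-≢ f k v λ { refl → k∉xs x∈xs })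

reinterpret : (I : Interp) → (AtomName → Interp.Δ I → Set) → (Ind → Interp.Δ I) → Interp
reinterpret I c i = record I { conc = c ; ind = i }

IsUnique-cong : {Δ : Set} {P Q : Δ → Set} → (∀ {d} → P d ⇔ Q d) → ∀ {d} → IsUnique P d ⇔ IsUnique Q d
IsUnique-cong P⇔Q = mk⇔ (λ (Pd , unique) → to P⇔Q Pd , λ e → unique e ∘ from P⇔Q)
                        (λ (Qd , unique) → from P⇔Q Qd , λ e → unique e ∘ to P⇔Q)

⟦⟧-reinterpret : ∀ C {c i} → Interp.conc I ≗ c on atomsC C →
                 ∀ {d} → ⟦ C ⟧ I d ⇔ ⟦ C ⟧ (reinterpret I c i) d
⟦⟧-reinterpret (atom A) agree {d} = ≡⇒ (cong-app (agree (here refl)) d)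
⟦⟧-reinterpret (neg C) agree = ¬-cong-⇔ (⟦⟧-reinterpret C agree)
⟦⟧-reinterpret (and C D) agree =
  ⟦⟧-reinterpret C (agree ∘ ∈-++⁺ˡ) ×-⇔ ⟦⟧-reinterpret D (agree ∘ ∈-++⁺ʳ _)
⟦⟧-reinterpret (exist r C) agree = Σ.congˡ (⇔-id _ ×-⇔ ⟦⟧-reinterpret C agree)
⟦⟧-reinterpret (ιloc C) agree = IsUnique-cong (⟦⟧-reinterpret C agree)
⟦⟧-reinterpret (ιglob C D) agree =
  Σ.congˡ (IsUnique-cong (⟦⟧-reinterpret C (agree ∘ ∈-++⁺ˡ))
           ×-⇔ ⟦⟧-reinterpret D (agree ∘ ∈-++⁺ʳ _))

SatA-reinterpret : ∀ α {c i} → Interp.conc I ≗ c on atomsA α → Interp.ind I ≗ i on indsA α →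
                   SatA I α → SatA (reinterpret I c i) α
SatA-reinterpret (a ∶ C) c-agree i-agree aC =
  subst (⟦ C ⟧ _) (i-agree (here refl)) (to (⟦⟧-reinterpret C c-agree) aC)
SatA-reinterpret {I} (rel r a b) c-agree i-agree rab =
  subst₂ (Interp.role I r) (i-agree (here refl)) (i-agree (there (here refl))) rab

All-SatA-reinterpret : ∀ {Γ c i} →
                       Interp.conc I ≗ c on concatMap atomsA Γ → Interp.ind I ≗ i on concatMap indsA Γ →
                       All (SatA I) Γ → All (SatA (reinterpret I c i)) Γ
All-SatA-reinterpret c-agree i-agree Γ-sat = tabulate λ {α} α∈Γ →
  SatA-reinterpret α (c-agree ∘ ∈-concatMap⁺ _ ∘ lose α∈Γ) (i-agree ∘ ∈-concatMap⁺ _ ∘ lose α∈Γ)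
                     (lookup Γ-sat α∈Γ)

atomsC⊆atomsO : (C , D) ∈ tbox O → atomsC C ++ atomsC D ⊆ atomsO O
atomsC⊆atomsO {O = O} CD∈T = ∈-++⁺ˡ ∘ ∈-concatMap⁺ _ ∘ lose CD∈T

Satisfies : Interp → Ontology → Branch → Set
Satisfies I O B = Models I O × All (SatA I) B

Satisfies-reinterpret : ∀ {c i} →
  Interp.conc I ≗ c on atomsO O → Interp.conc I ≗ c on concatMap atomsA B →
  Interp.ind I ≗ i on concatMap indsA (abox O) → Interp.ind I ≗ i on concatMap indsA B →
  Satisfies I O B → Satisfies (reinterpret I c i) O B
Satisfies-reinterpret {O = O} cO cB iO iB ((T-sat , A-sat) , B-sat) =
  (tabulate (λ { {C , D} CD∈T d →
      to (⟦⟧-reinterpret D (cO ∘ atomsC⊆atomsO {O = O} CD∈T ∘ ∈-++⁺ʳ _)) ∘ lookup T-sat CD∈T d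
      ∘ from (⟦⟧-reinterpret C (cO ∘ atomsC⊆atomsO {O = O} CD∈T ∘ ∈-++⁺ˡ)) })
  , All-SatA-reinterpret (cO ∘ ∈-++⁺ʳ _) iO A-sat)
  , All-SatA-reinterpret cB iB B-sat

_⟨_↦_⟩ : (I : Interp) → Ind → Interp.Δ I → Interp
I ⟨ b ↦ e ⟩ = reinterpret I (Interp.conc I) (update (Interp.ind I) b e)

_⟨_≔_⟩ : (I : Interp) → AtomName → (Interp.Δ I → Set) → Interp
I ⟨ A ≔ P ⟩ = reinterpret I (update (Interp.conc I) A P) (Interp.ind I)

Satisfies-⟨↦⟩ : ∀ {e} → FreshInd O B b → Satisfies I O B → Satisfies (I ⟨ b ↦ e ⟩) O B
Satisfies-⟨↦⟩ (b∉B , b∉O) =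
  Satisfies-reinterpret (λ _ → refl) (λ _ → refl) (update-≗ b∉O) (update-≗ b∉B)

Satisfies-⟨≔⟩ : ∀ {P} → FreshAtom O B A → Satisfies I O B → Satisfies (I ⟨ A ≔ P ⟩) O B
Satisfies-⟨≔⟩ (A∉B , A∉O) =
  Satisfies-reinterpret (update-≗ A∉O) (update-≗ A∉B) (λ _ → refl) (λ _ → refl)

⟦⟧-⟨↦⟩ : ∀ C {d e} → ⟦ C ⟧ I d → ⟦ C ⟧ (I ⟨ b ↦ e ⟩) d
⟦⟧-⟨↦⟩ C = to (⟦⟧-reinterpret C λ _ → refl)

⟦⟧-⟨≔⟩ : ∀ C {d P} → A ∉ atomsC C → ⟦ C ⟧ I d → ⟦ C ⟧ (I ⟨ A ≔ P ⟩) d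
⟦⟧-⟨≔⟩ C A∉C = to (⟦⟧-reinterpret C (update-≗ A∉C))

⟦A⟧-⟨A≔⟩ : ∀ {d P} → ⟦ atom A ⟧ (I ⟨ A ≔ P ⟩) d ⇔ P d
⟦A⟧-⟨A≔⟩ {A = A} {I = I} {d} {P} = ≡⇒ (cong-app (update-≡ (Interp.conc I) A P) d)

SatA-⟨↦⟩-self : ∀ C {e} → ⟦ C ⟧ I e → SatA (I ⟨ b ↦ e ⟩) (b ∶ C)
SatA-⟨↦⟩-self {I = I} {b = b} C {e} Ce =
  subst (⟦ C ⟧ _) (sym (update-≡ (Interp.ind I) b e)) (⟦⟧-⟨↦⟩ C Ce)

SatA-⟨↦⟩-other : ∀ C {e} → a ≢ b → SatA I (a ∶ C) → SatA (I ⟨ b ↦ e ⟩) (a ∶ C)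
SatA-⟨↦⟩-other {b = b} {I = I} C {e} a≢b aC =
  subst (⟦ C ⟧ _) (sym (update-≢ (Interp.ind I) b e a≢b)) (⟦⟧-⟨↦⟩ C aC)

FreshInd⇒≢ : FreshInd O B b → (a ∶ C) ∈ B → a ≢ b
FreshInd⇒≢ (b∉B , _) aC∈B refl = b∉B (∈-concatMap⁺ _ (lose aC∈B (here refl)))

FreshAtom⇒∉ : FreshAtom O B A → (a ∶ C) ∈ B → A ∉ atomsC C
FreshAtom⇒∉ (A∉B , _) aC∈B = A∉B ∘ ∈-concatMap⁺ _ ∘ lose aC∈B

¬IsUnique⇒other : ExcludedMiddle 0ℓ → {Δ : Set} {P : Δ → Set} {d : Δ} →
                  P d → ¬ IsUnique P d → ∃ λ e → P e × e ≢ d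
¬IsUnique⇒other em Pd ¬unique = em⇒dne em λ ¬other →
  ¬unique (Pd , λ e Pe → em⇒dne em λ e≢d → ¬other (e , Pe , e≢d))

IsUnique-transport : {Δ : Set} {P : Δ → Set} (Q : Δ → Set) {d x y : Δ} →
                     IsUnique P d → P x → P y → Q x → Q y
IsUnique-transport Q (_ , unique) Px Py = subst Q (trans (unique _ Px) (sym (unique _ Py)))

LocallySound : Ontology → Branch → List (List Assertion) → Set₁
LocallySound O B cons = Satisfiable O B → Any (λ Con → Satisfiable O (Con ++ B)) cons

extend : ∀ {Con} → Satisfies I O B → All (SatA I) Con → Satisfiable O (Con ++ B)
extend (M , B-sat) Con-sat = _ , M , ++⁺ Con-sat B-sat

sound-in-place : ∀ {Con} → (∀ {I} → Satisfies I O B → All (SatA I) Con) → LocallySound O B (Con ∷ [])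
sound-in-place Con-sat (_ , sat) = here (extend sat (Con-sat sat))

ι₂-sound : ∀ {a' a'' E} → (∀ {I} → Satisfies I O B → ∃ (IsUnique (⟦ C ⟧ I))) →
           (a' ∶ C) ∈ B → (a'' ∶ C) ∈ B → (a' ∶ E) ∈ B → LocallySound O B ((a'' ∶ E ∷ []) ∷ [])
ι₂-sound {E = E} C-unique q₁ q₂ q₃ = sound-in-place λ {I} sat@(_ , B-sat) →
  IsUnique-transport (⟦ E ⟧ I) (proj₂ (C-unique sat)) (lookup B-sat q₁) (lookup B-sat q₂) (lookup B-sat q₃)
  ∷ []

cut-sound : ExcludedMiddle 0ℓ → ∀ a C → LocallySound O B ((a ∶ C ∷ []) ∷ (a ∶ neg C ∷ []) ∷ [])
cut-sound em a C (I , sat) with em {SatA I (a ∶ C)}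
... | yes aC  = here (extend sat (aC ∷ []))
... | no  ¬aC = there (here (extend sat (¬aC ∷ [])))

¬⊓-sound : ExcludedMiddle 0ℓ → (a ∶ neg (and C D)) ∈ B →
           LocallySound O B ((a ∶ neg C ∷ []) ∷ (a ∶ neg D ∷ []) ∷ [])
¬⊓-sound {a = a} {C = C} em p (I , sat@(_ , B-sat)) with em {SatA I (a ∶ C)}
... | yes aC  = there (here (extend sat ((λ aD → lookup B-sat p (aC , aD)) ∷ [])))
... | no  ¬aC = here (extend sat (¬aC ∷ []))

∃-sound : ∀ b → (a ∶ exist r C) ∈ B → FreshInd O B b → LocallySound O B ((b ∶ C ∷ rel r a b ∷ []) ∷ [])
∃-sound {a = a} {r = r} {C = C} {O = O} b p fresh (I , sat@(_ , B-sat)) with lookup B-sat p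
... | e , rae , Ce = here (extend (Satisfies-⟨↦⟩ fresh sat) (SatA-⟨↦⟩-self C Ce ∷ rab ∷ []))
  where
  rab : SatA (I ⟨ b ↦ e ⟩) (rel r a b)
  rab = subst₂ (Interp.role I r) (sym (update-≢ (Interp.ind I) b e (FreshInd⇒≢ {O = O} fresh p)))
                                 (sym (update-≡ (Interp.ind I) b e)) rae

ιg1-sound : ∀ b → (a ∶ ιglob C D) ∈ B → FreshInd O B b → LocallySound O B ((b ∶ C ∷ b ∶ D ∷ []) ∷ [])
ιg1-sound {C = C} {D = D} b p fresh (I , sat@(_ , B-sat)) with lookup B-sat p
... | e , (Ce , _) , De =
  here (extend (Satisfies-⟨↦⟩ fresh sat) (SatA-⟨↦⟩-self C Ce ∷ SatA-⟨↦⟩-self D De ∷ []))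

¬ιl-sound : ExcludedMiddle 0ℓ → ∀ b A → (a ∶ neg (ιloc C)) ∈ B → FreshInd O B b → FreshAtom O B A →
            LocallySound O B ((a ∶ neg C ∷ []) ∷ (a ∶ neg (atom A) ∷ b ∶ C ∷ b ∶ atom A ∷ []) ∷ [])
¬ιl-sound {a = a} {C = C} {O = O} em b A p freshb freshA (I , sat@(_ , B-sat)) with em {SatA I (a ∶ C)}
... | no  ¬aC = here (extend sat (¬aC ∷ []))
... | yes aC with ¬IsUnique⇒other em aC (lookup B-sat p)
...   | e , Ce , e≢a = there (here (extend (Satisfies-⟨↦⟩ freshb (Satisfies-⟨≔⟩ freshA sat)) new))
  where
  J : Interp
  J = I ⟨ A ≔ (_≡ e) ⟩

  A-in-J : ∀ {d} → ⟦ atom A ⟧ J d ⇔ (d ≡ e)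
  A-in-J = ⟦A⟧-⟨A≔⟩ {A = A} {I = I}

  new : All (SatA (J ⟨ b ↦ e ⟩)) (a ∶ neg (atom A) ∷ b ∶ C ∷ b ∶ atom A ∷ [])
  new =  SatA-⟨↦⟩-other {I = J} (neg (atom A)) (FreshInd⇒≢ {O = O} freshb p) (e≢a ∘ sym ∘ to A-in-J)
       ∷ SatA-⟨↦⟩-self C (⟦⟧-⟨≔⟩ C (FreshAtom⇒∉ {O = O} freshA p) Ce)
       ∷ SatA-⟨↦⟩-self {I = J} {b = b} (atom A) (from A-in-J refl)
       ∷ []

¬ιg-sound : ExcludedMiddle 0ℓ → ∀ {a'} b b' A → (a ∶ neg (ιglob C D)) ∈ B →
            FreshInd O B b → FreshInd O B b' → b ≢ b' → FreshAtom O B A →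
            LocallySound O B ((a' ∶ neg C ∷ []) ∷ (a' ∶ neg D ∷ []) ∷
                              (b ∶ C ∷ b ∶ atom A ∷ b' ∶ C ∷ b' ∶ neg (atom A) ∷ []) ∷ [])
¬ιg-sound {C = C} {D = D} {O = O} em {a'} b b' A p freshb freshb' b≢b' freshA
          (I , sat@(_ , B-sat))
  with em {SatA I (a' ∶ C)} | em {SatA I (a' ∶ D)}
... | no  ¬a'C | _       = here (extend sat (¬a'C ∷ []))
... | yes _    | no ¬a'D = there (here (extend sat (¬a'D ∷ [])))
... | yes a'C  | yes a'D with ¬IsUnique⇒other em a'C (λ unique → lookup B-sat p (_ , unique , a'D))
...   | e , Ce , e≢x =
  there (there (here (extend (Satisfies-⟨↦⟩ freshb' (Satisfies-⟨↦⟩ freshb (Satisfies-⟨≔⟩ freshA sat)))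
                             new)))
  where
  x : Interp.Δ I
  x = Interp.ind I a'

  J : Interp
  J = I ⟨ A ≔ (_≡ x) ⟩

  A-in-J : ∀ {d} → ⟦ atom A ⟧ J d ⇔ (d ≡ x)
  A-in-J = ⟦A⟧-⟨A≔⟩ {A = A} {I = I}

  A∉C : A ∉ atomsC C
  A∉C = FreshAtom⇒∉ {O = O} freshA p ∘ ∈-++⁺ˡ

  new : All (SatA (J ⟨ b ↦ x ⟩ ⟨ b' ↦ e ⟩)) (b ∶ C ∷ b ∶ atom A ∷ b' ∶ C ∷ b' ∶ neg (atom A) ∷ [])
  new =  SatA-⟨↦⟩-other C b≢b' (SatA-⟨↦⟩-self C (⟦⟧-⟨≔⟩ C A∉C a'C))
       ∷ SatA-⟨↦⟩-other {I = J ⟨ b ↦ x ⟩} (atom A) b≢b'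
           (SatA-⟨↦⟩-self {I = J} {b = b} (atom A) (from A-in-J refl))
       ∷ SatA-⟨↦⟩-self C (⟦⟧-⟨↦⟩ C (⟦⟧-⟨≔⟩ C A∉C Ce))
       ∷ SatA-⟨↦⟩-self {I = J ⟨ b ↦ x ⟩} {b = b'} (neg (atom A)) (e≢x ∘ to A-in-J)
       ∷ []

lemma1 : ExcludedMiddle 0ℓ → (O : Ontology) (B : Branch)
         (cons : List (List Assertion)) → Step O B cons →
         Satisfiable O B → Any (λ Con → Satisfiable O (Con ++ B)) cons
lemma1 em O B _ (r-ABoxI p)  = sound-in-place λ ((_ , A-sat) , _) → lookup A-sat p ∷ []
lemma1 em O B _ (r-ABoxr p)  = sound-in-place λ ((_ , A-sat) , _) → lookup A-sat p ∷ []
lemma1 em O B _ (r-TBox p _) =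
  sound-in-place λ ((T-sat , _) , _) → (λ (aC , a¬D) → a¬D (lookup T-sat p _ aC)) ∷ []
lemma1 em O B _ (r-⊥ p q) (_ , _ , B-sat) = ⊥-elim (lookup B-sat q (lookup B-sat p))
lemma1 em O B _ (r-¬¬ p)     = sound-in-place λ (_ , B-sat) → em⇒dne em (lookup B-sat p) ∷ []
lemma1 em O B _ (r-⊓ p)      =
  sound-in-place λ (_ , B-sat) → let (aC , aD) = lookup B-sat p in aC ∷ aD ∷ []
lemma1 em O B _ (r-¬⊓ p)     = ¬⊓-sound em p
lemma1 em O B _ (r-∃ b p fresh) = ∃-sound b p fresh
lemma1 em O B _ (r-¬∃ p q)   =
  sound-in-place λ (_ , B-sat) → (λ a'C → lookup B-sat p (_ , lookup B-sat q , a'C)) ∷ []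
lemma1 em O B _ (r-ιg1 b p fresh) = ιg1-sound b p fresh
lemma1 em O B _ (r-ιg2 p q₁ q₂ q₃) =
  ι₂-sound (λ (_ , B-sat) → let (d , C-unique , _) = lookup B-sat p in d , C-unique) q₁ q₂ q₃
lemma1 em O B _ (r-¬ιg b b' A p _ freshb freshb' b≢b' freshA) =
  ¬ιg-sound em b b' A p freshb freshb' b≢b' freshA
lemma1 em O B _ (r-cutg {C = C} {a' = a'} _ _) = cut-sound em a' C
lemma1 em O B _ (r-ιl1 p)    = sound-in-place λ (_ , B-sat) → proj₁ (lookup B-sat p) ∷ []
lemma1 em O B _ (r-ιl2 p q₁ q₂ q₃) = ι₂-sound (λ (_ , B-sat) → _ , lookup B-sat p) q₁ q₂ q₃
lemma1 em O B _ (r-¬ιl b A p fresh freshA) = ¬ιl-sound em b A p fresh freshA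
lemma1 em O B _ (r-cutl {C = C} {a' = a'} _ _) = cut-sound em a' C
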